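{- Let $A$ be a nonempty finite set and let $(\mathcal P,\mathcal S)$ be a scenario on $A$. If $(\mathcal P,\mathcal S)$ has an exact search tree (i.e. an exact search tree for $(\mathcal P,\mathcal S)$), then $(\mathcal P,\mathcal S)$ has a tree decomposition.
   Context: A partition of $A$ is a set of pairwise disjoint subsets of $A$ (empty sets allowed) with union $A$; $\textup{Part}(A)$ is the set of partitions. $P_1$ is coarser than $P_2$ if every set of $P_1$ is a union of sets of $P_2$. $X^c=A\setminus X$. A scenario on $A$ is a pair $(\mathcal P,\mathcal S)$, $\mathcal P\subseteq\textup{Part}(A)$, $\mathcal S\subseteq 2^A$, with: (SC1) $\mathcal P$ closed under coarser partitions; (SC2) if $X\subseteq S\in\mathcal S$ and $X\in P$ for some $P\in\mathcal P$ then $X\in\mathcal S$; (SC3) $\{S,S^c\}\in\mathcal P$ for all $S\in\mathcal S$. A bidirected tree is obtained from an undirected tree with at least one edge by replacing each edge by two opposite arcs; leaves (degree at most one)/internal nodes and neighbours refer to the underlying tree. A search tree for $(\mathcal P,\mathcal S)$ is a pair $(T,l)$, $T$ a bidirected tree, $l$ a map from arcs to $2^A$, such that: for every internal node $t$ with neighbours $t_1,\dots,t_n$, $\pi_t:=\{l(t,t_i)\mid i\in[n]\}$ is a partition of $A$ and $\pi_t\in\mathcal P$; $l(s,t)\cap l(t,s)=\emptyset$ for every arc; and $l(s,t)\in\mathcal S$ for every arc $(s,t)$ with $t$ a leaf. It is exact if $l(s,t)\cup l(t,s)=A$ for every arc $(s,t)$. A tree decomposition of $(\mathcal P,\mathcal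 S)$ is a pair $(T,\tau)$ where $T$ is a (undirected, nonempty) tree and $\tau:L(T)\to\mathcal S$ ($L(T)$ the leaves) such that $\tau(L(T))$ is a partition of $A$ and for every internal node $t$, $P_t:=\{\bigcup\tau(L(T)\cap V(T'))\mid T'\text{ a component of }T-t\}\in\mathcal P$. -}

module Defs where

open import Data.Nat using (ℕ; suc; _≤_)
open import Data.Fin using (Fin; zero; suc; inject₁; fromℕ)
open import Data.Fin.Subset using (Subset; _∈_; _⊆_; _∩_; _∪_; ∁; ⊥; ⊤; ∣_∣)
open import Data.Bool using (Bool; true)
open import Data.Vec using (tabulate)
open import Data.Product using (Σ; ∃; _×_)
open import Data.Sum using (_⊎_)
open import Data.Unit using () renaming (⊤ to Unit)
open import Function using (_⇔_)
open import Function.Definitions using (Injective)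
open import Relation.Nullary using (¬_)
open import Relation.Binary.PropositionalEquality using (_≡_; _≢_)

-- The ground set A is  Fin n ; subsets of A are  Subset n  (Vec Bool n).
-- A set of subsets of A ("family") is a predicate on subsets.

Fam : ℕ → Set₁
Fam n = Subset n → Set

module _ {n : ℕ} where

  Disjoint : Subset n → Subset n → Set
  Disjoint X Y = X ∩ Y ≡ ⊥

  IsUnionOf : Subset n → Fam n → Set
  IsUnionOf X G = ∀ (a : Fin n) → (a ∈ X) ⇔ (∃ λ Y → G Y × a ∈ Y)

  -- P is a partition of A: pairwise disjoint members (empty set allowed),
  -- with union A.
  IsPartition : Fam n → Set
  IsPartition P =
    (∀ X Y → P X → P Y → X ≢ Y → Disjoint X Y) ×
    IsUnionOf ⊤ P

  Coarser : Fam n → Fam n → Set₁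
  Coarser P₁ P₂ = ∀ X → P₁ X → Σ (Fam n) λ G → (∀ Y → G Y → P₂ Y) × IsUnionOf X G

  SameFam : Fam n → Fam n → Set
  SameFam P Q = ∀ X → P X ⇔ Q X

  _∈Fam_ : Fam n → (Fam n → Set) → Set₁
  P ∈Fam 𝒫 = Σ (Fam n) λ Q → 𝒫 Q × SameFam Q P

  pairFam : Subset n → Subset n → Fam n
  pairFam S T X = X ≡ S ⊎ X ≡ T

  record IsScenario (𝒫 : Fam n → Set) (𝒮 : Subset n → Set) : Set₁ where
    field
      ⊆Part : ∀ P → 𝒫 P → IsPartition P
      SC1   : ∀ P₁ P₂ → IsPartition P₁ → P₂ ∈Fam 𝒫 → Coarser P₁ P₂ → P₁ ∈Fam 𝒫
      SC2   : ∀ X S P → X ⊆ S → 𝒮 S → P ∈Fam 𝒫 → P X → 𝒮 X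
      SC3   : ∀ S → 𝒮 S → pairFam S (∁ S) ∈Fam 𝒫

module _ {m : ℕ} (adj : Fin m → Fin m → Bool) where

  data Walk (ok : Fin m → Set) : Fin m → Fin m → Set where
    here : ∀ {u} → ok u → Walk ok u u
    step : ∀ {u w v} → ok u → adj u w ≡ true → Walk ok w v → Walk ok u v

  Connected : Set
  Connected = ∀ u v → Walk (λ _ → Unit) u v

  Cycle : Set
  Cycle = Σ ℕ λ k → Σ (Fin (suc (suc (suc k))) → Fin m) λ c →
            Injective _≡_ _≡_ c ×
            (∀ (i : Fin (suc (suc k))) → adj (c (inject₁ i)) (c (suc i)) ≡ true) ×
            adj (c (fromℕ (suc (suc k)))) (c zero) ≡ true

  IsTree : Set
  IsTree = (1 ≤ m) ×
           (∀ u v → adj u v ≡ adj v u) ×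
           (∀ u → adj u u ≢ true) ×
           Connected ×
           ¬ Cycle

  degree : Fin m → ℕ
  degree t = ∣ tabulate (adj t) ∣

  Leaf : Fin m → Set
  Leaf t = degree t ≤ 1

  Internal : Fin m → Set
  Internal t = ¬ Leaf t

  HasEdge : Set
  HasEdge = ∃ λ u → ∃ λ v → adj u v ≡ true

-- Search trees (on bidirected trees; arcs = ordered adjacent pairs)

module _ {n : ℕ} (𝒫 : Fam n → Set) (𝒮 : Subset n → Set) where

  record IsSearchTree {m : ℕ} (adj : Fin m → Fin m → Bool)
                      (l : Fin m → Fin m → Subset n) : Set₁ where
    field
      tree      : IsTree adj
      atLeastOneEdge : HasEdge adj
      πPartition : ∀ t → Internal adj t →
                   IsPartition (λ X → ∃ λ u → adj t u ≡ true × l t u ≡ X)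
      π∈𝒫       : ∀ t → Internal adj t →
                   (λ X → ∃ λ u → adj t u ≡ true × l t u ≡ X) ∈Fam 𝒫
      disjoint   : ∀ s t → adj s t ≡ true → Disjoint (l s t) (l t s)
      leaf∈𝒮    : ∀ s t → adj s t ≡ true → Leaf adj t → 𝒮 (l s t)

  IsExact : {m : ℕ} (adj : Fin m → Fin m → Bool) (l : Fin m → Fin m → Subset n) → Set
  IsExact adj l = ∀ s t → adj s t ≡ true → l s t ∪ l t s ≡ ⊤

  HasExactSearchTree : Set₁
  HasExactSearchTree =
    Σ ℕ λ m → Σ (Fin m → Fin m → Bool) λ adj → Σ (Fin m → Fin m → Subset n) λ l →
      IsSearchTree adj l × IsExact adj l

  -- Tree decompositions.  τ is given on all vertices but only its values
  -- on leaves matter.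

  record IsTreeDecomposition {m : ℕ} (adj : Fin m → Fin m → Bool)
                             (τ : Fin m → Subset n) : Set₁ where
    -- the set of subsets  ⋃ τ(L(T) ∩ V(T'))  for T' a component of T - t;
    -- the component of T - t containing v (v ≠ t) is the set of vertices
    -- reachable from v by walks avoiding t.
    Pcomp : Fin m → Fam n
    Pcomp t X = ∃ λ v → v ≢ t ×
               IsUnionOf X (λ Y → ∃ λ w → Walk adj (λ x → x ≢ t) v w × Leaf adj w × τ w ≡ Y)
    field
      tree     : IsTree adj
      τ∈𝒮     : ∀ t → Leaf adj t → 𝒮 (τ t)
      τPartition : IsPartition (λ X → ∃ λ t → Leaf adj t × τ t ≡ X)
      Pt∈𝒫    : ∀ t → Internal adj t → Pcomp t ∈Fam 𝒫

  HasTreeDecomposition : Set₁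
  HasTreeDecomposition =
    Σ ℕ λ m → Σ (Fin m → Fin m → Bool) λ adj → Σ (Fin m → Subset n) λ τ →
      IsTreeDecomposition adj τ

module Submission where

-- For separated l the converse holds too, so l(t,u) is the union of τ
--    over that branch: the partition P_t of the decomposition is exactly π_t,
--    and (T, τ) is a tree decomposition.
--  * Pruning: if a ∈ l(t,u) ∩ l(t,u') with u ≠ u', relabel the branch of
--    T - t at u' by ∅ on arcs pointing away from t and by A on arcs pointing
--    towards t.  By SC1 (the new partitions are coarsenings) and SC2 (∅ ∈ 𝒮)
--    this is again an exact search tree, and fewer leaves have nonempty τ.
--  * Separation: iterating the pruning yields separated labels, hence the
--    theorem.

open import Defs
open import Data.Nat using (ℕ; zero; suc; _≤_; _<_; z≤n; s≤s)
import Data.Nat.Properties as ℕP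
open import Data.Fin using (Fin; zero; suc; toℕ; inject₁; fromℕ)
import Data.Fin.Properties as FinP
open import Data.Fin.Properties using (_≟_)
open import Data.Fin.Subset using (Subset; _∈_; _∉_; _⊂_; _∩_; _∪_; ⊥; ⊤; ∣_∣; ⁅_⁆; Nonempty)
import Data.Fin.Subset.Properties as SubP
open import Data.Bool using (Bool; true)
import Data.Bool.Properties as BoolP
open import Data.Vec using (tabulate)
open import Data.Vec.Properties using (lookup∘tabulate; lookup⇒[]=; []=⇒lookup)
open import Data.Product using (Σ; ∃; _×_; _,_; proj₁; proj₂)
open import Data.Sum using (_⊎_; inj₁; inj₂; map₂)
open import Data.Unit using (tt) renaming (⊤ to Unit)
open import Data.Empty using (⊥-elim) renaming (⊥ to Void)
open import Function using (mk⇔; Equivalence)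
open import Relation.Nullary using (¬_; Dec; yes; no; does; _×-dec_; ¬?)
open import Relation.Nullary.Decidable using (dec-true; toSum)
open import Relation.Binary.PropositionalEquality
  using (_≡_; _≢_; refl; sym; trans; cong; subst)

-- Subsets and families of subsets

module _ {n : ℕ} where

  ∈-disjoint : ∀ {X Y : Subset n} {a} → X ∩ Y ≡ ⊥ → a ∈ X → a ∈ Y → Void
  ∈-disjoint {a = a} X∩Y≡⊥ p q = SubP.∉⊥ (subst (a ∈_) X∩Y≡⊥ (SubP.x∈p∩q⁺ (p , q)))

  disjoint-intro : ∀ {X Y : Subset n} → (∀ a → a ∈ X → a ∈ Y → Void) → X ∩ Y ≡ ⊥
  disjoint-intro {X} {Y} f =
    SubP.Empty-unique λ (a , p) → let (q , r) = SubP.x∈p∩q⁻ X Y p in f a q r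

  ∈-cover : ∀ {X Y : Subset n} {a} → X ∪ Y ≡ ⊤ → a ∉ Y → a ∈ X
  ∈-cover {X} {Y} {a} X∪Y≡⊤ a∉Y with SubP.x∈p∪q⁻ X Y (subst (a ∈_) (sym X∪Y≡⊤) SubP.∈⊤)
  ... | inj₁ p = p
  ... | inj₂ q = ⊥-elim (a∉Y q)

  sameFam-trans : ∀ {P Q R : Fam n} → SameFam P Q → SameFam Q R → SameFam P R
  sameFam-trans P≈Q Q≈R X =
    mk⇔ (λ x → Equivalence.to (Q≈R X) (Equivalence.to (P≈Q X) x))
        (λ x → Equivalence.from (P≈Q X) (Equivalence.from (Q≈R X) x))

  partition-resp : ∀ {P Q : Fam n} → SameFam P Q → IsPartition P → IsPartition Q
  partition-resp P≈Q (disj , cover) =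
    (λ X Y qX qY X≢Y → disj X Y (Equivalence.from (P≈Q X) qX) (Equivalence.from (P≈Q Y) qY) X≢Y) ,
    (λ a → mk⇔ (λ x → let (Y , pY , r) = Equivalence.to (cover a) x in Y , Equivalence.to (P≈Q Y) pY , r)
               (λ (Y , qY , r) → Equivalence.from (cover a) (Y , Equivalence.from (P≈Q Y) qY , r)))

  union-empty : IsUnionOf (⊥ {n}) (λ _ → Void)
  union-empty a = mk⇔ (λ p → ⊥-elim (SubP.∉⊥ p)) (λ ())

  union-singleton : ∀ (X : Subset n) → IsUnionOf X (λ Y → Y ≡ X)
  union-singleton X a = mk⇔ (λ p → X , refl , p) (λ { (_ , refl , p) → p })

  coarser-by-blocks : ∀ {P Q : Fam n} → IsPartition Q → (∀ X → P X → X ≡ ⊥ ⊎ X ≡ ⊤ ⊎ Q X) → Coarser P Q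
  coarser-by-blocks {Q = Q} (_ , Q-cover) shape X pX with shape X pX
  ... | inj₁ refl        = (λ _ → Void) , (λ _ ()) , union-empty
  ... | inj₂ (inj₁ refl) = Q , (λ _ qY → qY) , Q-cover
  ... | inj₂ (inj₂ qX)   = (λ Y → Y ≡ X) , (λ { _ refl → qX }) , union-singleton X

  partition-dropping-blocks : ∀ {P Q : Fam n} → IsPartition Q → (∀ X → P X → X ≡ ⊥ ⊎ Q X) →
                              IsUnionOf ⊤ P → IsPartition P
  partition-dropping-blocks {P} (Q-disj , _) shape P-cover = disj , P-cover
    where
    disj : ∀ X Y → P X → P Y → X ≢ Y → X ∩ Y ≡ ⊥
    disj X Y pX pY X≢Y with shape X pX | shape Y pY
    ... | inj₁ refl | _         = SubP.∩-zeroˡ Y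
    ... | inj₂ _    | inj₁ refl = SubP.∩-zeroʳ X
    ... | inj₂ qX   | inj₂ qY   = Q-disj X Y qX qY X≢Y

  partition-∅-A : ∀ {P : Fam n} → (∀ X → P X → X ≡ ⊥ ⊎ X ≡ ⊤) → P ⊤ → IsPartition P
  partition-∅-A {P} shape p⊤ = disj , λ a → mk⇔ (λ _ → ⊤ , p⊤ , SubP.∈⊤) (λ _ → SubP.∈⊤)
    where
    disj : ∀ X Y → P X → P Y → X ≢ Y → X ∩ Y ≡ ⊥
    disj X Y pX pY X≢Y with shape X pX | shape Y pY
    ... | inj₁ refl | _         = SubP.∩-zeroˡ Y
    ... | inj₂ _    | inj₁ refl = SubP.∩-zeroʳ X
    ... | inj₂ refl | inj₂ refl = ⊥-elim (X≢Y refl)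

module _ {k : ℕ} {P : Fin k → Set} (P? : ∀ x → Dec (P x)) where

  select : Subset k
  select = tabulate (λ x → does (P? x))

  ∈-select⁺ : ∀ {x} → P x → x ∈ select
  ∈-select⁺ {x} px = lookup⇒[]= x select (trans (lookup∘tabulate _ x) (dec-true (P? x) px))

  ∈-select⁻ : ∀ {x} → x ∈ select → P x
  ∈-select⁻ {x} p with P? x | trans (sym (lookup∘tabulate (λ y → does (P? y)) x)) ([]=⇒lookup p)
  ... | yes px | _ = px
  ... | no _   | ()

-- Walks in a symmetric graph

module Walks {m : ℕ} (adj : Fin m → Fin m → Bool) (adj-sym : ∀ u v → adj u v ≡ adj v u) where

  E : Fin m → Fin m → Set
  E u v = adj u v ≡ true

  E-sym : ∀ {u v} → E u v → E v u
  E-sym {u} {v} e = trans (adj-sym v u) e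

  Avoid : Fin m → Fin m → Set
  Avoid t z = z ≢ t

  module _ {ok : Fin m → Set} where

    len : ∀ {a b} → Walk adj ok a b → ℕ
    len (here _)     = 0
    len (step _ _ W) = suc (len W)

    -- the i-th vertex of a walk (its endpoint for i ≥ len)
    vertexAt : ∀ {a b} → Walk adj ok a b → ℕ → Fin m
    vertexAt (here {u} _)     _       = u
    vertexAt (step {u} _ _ W) zero    = u
    vertexAt (step _ _ W)     (suc i) = vertexAt W i

    _∈W_ : ∀ {a b} → Fin m → Walk adj ok a b → Set
    x ∈W here {u} _     = x ≡ u
    x ∈W step {u} _ _ W = x ≡ u ⊎ x ∈W W

    _∈W?_ : ∀ {a b} (x : Fin m) (W : Walk adj ok a b) → Dec (x ∈W W)
    x ∈W? here {u} _ = x ≟ u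
    x ∈W? step {u} _ _ W with x ≟ u | x ∈W? W
    ... | yes p | _     = yes (inj₁ p)
    ... | no _  | yes q = yes (inj₂ q)
    ... | no p  | no q  = no λ { (inj₁ r) → p r ; (inj₂ r) → q r }

    Simple : ∀ {a b} → Walk adj ok a b → Set
    Simple (here _)         = Unit
    Simple (step {u} _ _ W) = ¬ (u ∈W W) × Simple W

    ok-start : ∀ {a b} → Walk adj ok a b → ok a
    ok-start (here o)     = o
    ok-start (step o _ _) = o

    ok-end : ∀ {a b} → Walk adj ok a b → ok b
    ok-end (here o)     = o
    ok-end (step _ _ W) = ok-end W

    ok-member : ∀ {a b x} (W : Walk adj ok a b) → x ∈W W → ok x
    ok-member (here o)     refl        = o
    ok-member (step o _ _) (inj₁ refl) = o
    ok-member (step _ _ W) (inj₂ p)    = ok-member W p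

    start∈W : ∀ {a b} (W : Walk adj ok a b) → a ∈W W
    start∈W (here _)     = refl
    start∈W (step _ _ _) = inj₁ refl

    suffix : ∀ {a b x} (W : Walk adj ok a b) → x ∈W W → Walk adj ok x b
    suffix (here o)     refl        = here o
    suffix (step o e W) (inj₁ refl) = step o e W
    suffix (step _ _ W) (inj₂ p)    = suffix W p

    suffix-⊆ : ∀ {a b x y} (W : Walk adj ok a b) (p : x ∈W W) → y ∈W suffix W p → y ∈W W
    suffix-⊆ (here o)     refl        q = q
    suffix-⊆ (step o e W) (inj₁ refl) q = q
    suffix-⊆ (step _ _ W) (inj₂ p)    q = inj₂ (suffix-⊆ W p q)

    suffix-simple : ∀ {a b x} (W : Walk adj ok a b) (p : x ∈W W) → Simple W → Simple (suffix W p)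
    suffix-simple (here o)     refl        s = s
    suffix-simple (step o e W) (inj₁ refl) s = s
    suffix-simple (step _ _ W) (inj₂ p)    s = suffix-simple W p (proj₂ s)

    start∉suffix : ∀ {a b x} (W : Walk adj ok a b) → Simple W → (p : x ∈W W) → x ≢ a →
                   ¬ (a ∈W suffix W p)
    start∉suffix (here _)     _        refl        x≢a _ = x≢a refl
    start∉suffix (step _ _ W) _        (inj₁ refl) x≢a _ = x≢a refl
    start∉suffix (step _ _ W) (a∉W , _) (inj₂ p)   x≢a q = a∉W (suffix-⊆ W p q)

    prefix : ∀ {a b x} (W : Walk adj ok a b) → x ∈W W → Walk adj ok a x
    prefix (here o)     refl        = here o
    prefix (step o e W) (inj₁ refl) = here o
    prefix (step o e W) (inj₂ p)    = step o e (prefix W p)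

    simplify : ∀ {a b} → Walk adj ok a b → Σ (Walk adj ok a b) Simple
    simplify (here o) = here o , tt
    simplify (step {u} o e W) with simplify W
    ... | W' , s with u ∈W? W'
    ... | yes p = suffix W' p , suffix-simple W' p s
    ... | no p  = step o e W' , p , s

    snoc : ∀ {a b c} → Walk adj ok a b → ok c → E b c → Walk adj ok a c
    snoc (here o)     o' e' = step o e' (here o')
    snoc (step o e W) o' e' = step o e (snoc W o' e')

    _++W_ : ∀ {a b c} → Walk adj ok a b → Walk adj ok b c → Walk adj ok a c
    here o       ++W W' = W'
    step o e W   ++W W' = step o e (W ++W W')

    reverse : ∀ {a b} → Walk adj ok a b → Walk adj ok b a
    reverse (here o)     = here o
    reverse (step o e W) = snoc (reverse W) o (E-sym e)

    -- properties of positions, used to present a simple walk as a cycle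
    -- (cycles are indexed by Fin in Defs)
    vertexAt-0 : ∀ {a b} (W : Walk adj ok a b) → vertexAt W 0 ≡ a
    vertexAt-0 (here _)     = refl
    vertexAt-0 (step _ _ _) = refl

    vertexAt-len : ∀ {a b} (W : Walk adj ok a b) → vertexAt W (len W) ≡ b
    vertexAt-len (here _)     = refl
    vertexAt-len (step _ _ W) = vertexAt-len W

    vertexAt-ok : ∀ {a b} (W : Walk adj ok a b) i → ok (vertexAt W i)
    vertexAt-ok (here o)     _       = o
    vertexAt-ok (step o _ _) zero    = o
    vertexAt-ok (step _ _ W) (suc i) = vertexAt-ok W i

    vertexAt-∈ : ∀ {a b} (W : Walk adj ok a b) i → vertexAt W i ∈W W
    vertexAt-∈ (here o)     _       = refl
    vertexAt-∈ (step o _ _) zero    = inj₁ refl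
    vertexAt-∈ (step _ _ W) (suc i) = inj₂ (vertexAt-∈ W i)

    vertexAt-adj : ∀ {a b} (W : Walk adj ok a b) i → i < len W → E (vertexAt W i) (vertexAt W (suc i))
    vertexAt-adj (step _ e W) zero    _         = subst (E _) (sym (vertexAt-0 W)) e
    vertexAt-adj (step _ _ W) (suc i) (s≤s i<) = vertexAt-adj W i i<

    vertexAt-injective : ∀ {a b} (W : Walk adj ok a b) → Simple W → ∀ i j →
                         vertexAt W i ≡ vertexAt W j → i ≤ len W → j ≤ len W → i ≡ j
    vertexAt-injective (here _)     _ zero    zero    _  _        _        = refl
    vertexAt-injective (step _ _ W) s zero    zero    _  _        _        = refl
    vertexAt-injective (step _ _ W) s zero    (suc j) eq _        _        =
      ⊥-elim (proj₁ s (subst (_∈W W) (sym eq) (vertexAt-∈ W j)))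
    vertexAt-injective (step _ _ W) s (suc i) zero    eq _        _        =
      ⊥-elim (proj₁ s (subst (_∈W W) eq (vertexAt-∈ W i)))
    vertexAt-injective (step _ _ W) s (suc i) (suc j) eq (s≤s i≤) (s≤s j≤) =
      cong suc (vertexAt-injective W (proj₂ s) i j eq i≤ j≤)

  restrict : ∀ {ok ok' : Fin m → Set} {a b} (W : Walk adj ok a b) →
             (∀ z → z ∈W W → ok' z) → Walk adj ok' a b
  restrict (here o)     f = here (f _ refl)
  restrict (step o e W) f = step (f _ (inj₁ refl)) e (restrict W (λ z p → f z (inj₂ p)))

  weaken : ∀ {ok ok' : Fin m → Set} {a b} → (∀ z → ok z → ok' z) → Walk adj ok a b → Walk adj ok' a b
  weaken f W = restrict W (λ z p → f z (ok-member W p))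

  avoiding : ∀ {ok : Fin m → Set} {a b x} (W : Walk adj ok a b) → ¬ (x ∈W W) → Walk adj (Avoid x) a b
  avoiding W x∉W = restrict W (λ z p z≡x → x∉W (subst (_∈W W) z≡x p))

-- Trees: acyclicity in the form used below

module Trees {m : ℕ} {adj : Fin m → Fin m → Bool} (tree : IsTree adj) where

  open Walks adj (proj₁ (proj₂ tree)) public

  connected : Connected adj
  connected = proj₁ (proj₂ (proj₂ (proj₂ tree)))

  E-irrefl : ∀ {u v} → E u v → u ≢ v
  E-irrefl {u} e refl = proj₁ (proj₂ (proj₂ tree)) u e

  neighbour-distinct : ∀ {t u} → E t u → u ≢ t
  neighbour-distinct e u≡t = E-irrefl e (sym u≡t)

  cycle-through : ∀ (k : ℕ) (x : Fin m) (f : ℕ → Fin m) →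
                  (∀ i j → f i ≡ f j → i ≤ suc k → j ≤ suc k → i ≡ j) →
                  (∀ i → i ≤ suc k → x ≢ f i) →
                  (∀ i → i < suc k → E (f i) (f (suc i))) →
                  E x (f 0) → E (f (suc k)) x → Cycle adj
  cycle-through k x f f-inj x∉f f-adj e₀ e₁ = k , c , c-inj , c-adj , c-closed
    where
    c : Fin (suc (suc (suc k))) → Fin m
    c zero    = x
    c (suc i) = f (toℕ i)
    bound : ∀ (i : Fin (suc (suc k))) → toℕ i ≤ suc k
    bound i = ℕP.≤-pred (FinP.toℕ<n i)
    c-inj : ∀ {i j} → c i ≡ c j → i ≡ j
    c-inj {zero}  {zero}  _  = refl
    c-inj {zero}  {suc j} eq = ⊥-elim (x∉f (toℕ j) (bound j) eq)
    c-inj {suc i} {zero}  eq = ⊥-elim (x∉f (toℕ i) (bound i) (sym eq))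
    c-inj {suc i} {suc j} eq = cong suc (FinP.toℕ-injective (f-inj _ _ eq (bound i) (bound j)))
    c-adj : ∀ (i : Fin (suc (suc k))) → adj (c (inject₁ i)) (c (suc i)) ≡ true
    c-adj zero    = e₀
    c-adj (suc j) = subst (λ z → E (f z) (f (suc (toℕ j)))) (sym (FinP.toℕ-inject₁ j))
                          (f-adj (toℕ j) (FinP.toℕ<n j))
    c-closed : adj (c (fromℕ (suc (suc k)))) (c zero) ≡ true
    c-closed = subst (λ z → E (f z) x) (sym (FinP.toℕ-fromℕ (suc k))) e₁

  neighbours-separated : ∀ {x y z} → E x y → E x z → y ≢ z → ¬ Walk adj (Avoid x) y z
  neighbours-separated {x} e₁ e₂ y≢z W with simplify W
  ... | here _ , _ = y≢z refl
  ... | S@(step _ _ S') , s =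
    proj₂ (proj₂ (proj₂ (proj₂ tree)))
      (cycle-through (len S') x (vertexAt S) (vertexAt-injective S s)
         (λ i _ eq → vertexAt-ok S i (sym eq)) (vertexAt-adj S)
         (subst (E x) (sym (vertexAt-0 S)) e₁)
         (subst (λ v → E v x) (sym (vertexAt-len S)) (E-sym e₂)))

  -- Simple walks have fewer than m steps (pigeonhole).
  simple-short : ∀ {ok a b} (W : Walk adj ok a b) → Simple W → len W < m
  simple-short W s with m ℕP.≤? len W
  ... | no m≰len = ℕP.≰⇒> m≰len
  ... | yes m≤len with FinP.pigeonhole (s≤s m≤len) (λ i → vertexAt W (toℕ i))
  ... | i , j , i<j , eq =
    ⊥-elim (ℕP.<⇒≢ i<j (vertexAt-injective W s (toℕ i) (toℕ j) eq (bound i) (bound j)))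
    where
    bound : ∀ (i : Fin (suc (len W))) → toℕ i ≤ len W
    bound i = ℕP.≤-pred (FinP.toℕ<n i)

  -- Reachability in T - t is decidable: search walks of length < m.
  ShortWalk : ℕ → Fin m → Fin m → Fin m → Set
  ShortWalk k t u y = Σ (Walk adj (Avoid t) u y) (λ W → len W ≤ k)

  shortWalk? : ∀ k t u y → Dec (ShortWalk k t u y)
  shortWalk? k t u y with u ≟ t | u ≟ y
  ... | yes refl | _        = no (λ (W , _) → ok-start W refl)
  ... | no u≢t   | yes refl = yes (here u≢t , z≤n)
  ... | no u≢t   | no u≢y   = search k
    where
    search : ∀ k → Dec (ShortWalk k t u y)
    search zero = no λ { (here _ , _) → u≢y refl ; (step _ _ _ , ()) }
    search (suc k) with FinP.any? (λ z → (adj u z BoolP.≟ true) ×-dec shortWalk? k t z y)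
    ... | yes (z , e , W , len≤k) = yes (step u≢t e W , s≤s len≤k)
    ... | no ¬next = no λ { (here _ , _) → u≢y refl ; (step _ e W , s≤s len≤k) → ¬next (_ , e , W , len≤k) }

  reachable? : ∀ t u y → Dec (Walk adj (Avoid t) u y)
  reachable? t u y with shortWalk? m t u y
  ... | yes (W , _) = yes W
  ... | no ¬short   = no λ W → let (S , s) = simplify W in ¬short (S , ℕP.<⇒≤ (simple-short S s))

  first-entry : ∀ {ok v t} → Walk adj ok v t → v ≢ t → Σ (Fin m) λ u → E u t × Walk adj (Avoid t) v u
  first-entry (here _) v≢t = ⊥-elim (v≢t refl)
  first-entry {t = t} (step {w = w} _ e W) v≢t with w ≟ t
  ... | yes refl = _ , e , here v≢t
  ... | no w≢t with first-entry W w≢t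
  ... | u , e' , W' = u , e' , step v≢t e W'

  avoid-transfer : ∀ {u v t y} → E u v → E u t → v ≢ t → Walk adj (Avoid u) v y → Walk adj (Avoid t) v y
  avoid-transfer {u} {v} e-uv e-ut v≢t W =
    restrict W (λ z p z≡t → neighbours-separated e-uv e-ut v≢t (subst (Walk adj (Avoid u) v) z≡t (prefix W p)))

  leaf? : ∀ w → Dec (Leaf adj w)
  leaf? w = degree adj w ℕP.≤? 1

  leaf-neighbour-unique : ∀ {w a b} → Leaf adj w → E w a → E w b → a ≡ b
  leaf-neighbour-unique {w} {a} {b} leaf e-a e-b with a ≟ b
  ... | yes a≡b = a≡b
  ... | no a≢b  = ⊥-elim (ℕP.<⇒≱ (subst (_< degree adj w) (SubP.∣⁅x⁆∣≡1 a) (SubP.p⊂q⇒∣p∣<∣q∣ ⁅a⁆⊂N)) leaf)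
    where
    neighbour : ∀ {z} → E w z → z ∈ tabulate (adj w)
    neighbour {z} e = lookup⇒[]= z _ (trans (lookup∘tabulate (adj w) z) e)
    ⁅a⁆⊂N : ⁅ a ⁆ ⊂ tabulate (adj w)
    ⁅a⁆⊂N = (λ p → subst (_∈ tabulate (adj w)) (sym (SubP.x∈⁅y⁆⇒x≡y a p)) (neighbour e-a)) ,
            b , neighbour e-b , λ p → a≢b (sym (SubP.x∈⁅y⁆⇒x≡y a p))

  avoid-leaf : ∀ {ok w x y} → Leaf adj w → Walk adj ok x y → x ≢ w → y ≢ w → Walk adj (Avoid w) x y
  avoid-leaf leaf (here _) x≢w _ = here x≢w
  avoid-leaf {w = w} leaf (step {w = z} o e W) x≢w y≢w with z ≟ w
  ... | no z≢w = step x≢w e (avoid-leaf leaf W z≢w y≢w)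
  avoid-leaf leaf (step o e (here _)) x≢w y≢w | yes refl = ⊥-elim (y≢w refl)
  avoid-leaf {w = w} {x = x} leaf (step o e (step {w = v} o' e' W)) x≢w y≢w | yes refl =
    subst (λ z → Walk adj (Avoid w) z _) v≡x (avoid-leaf leaf W (λ v≡w → x≢w (trans (sym v≡x) v≡w)) y≢w)
    where
    -- the walk enters and leaves the leaf w through its only neighbour
    v≡x : v ≡ x
    v≡x = leaf-neighbour-unique leaf e' (E-sym e)

  leaf-isolated : ∀ {s w t} → Leaf adj w → E s w → w ≢ t → ¬ Walk adj (Avoid s) w t
  leaf-isolated leaf e w≢t (here _)      = w≢t refl
  leaf-isolated leaf e w≢t (step o e' W) = ok-start W (leaf-neighbour-unique leaf e' (E-sym e))

  neighbour-exists : HasEdge adj → ∀ v → Σ (Fin m) (E v)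
  neighbour-exists (a , b , e) v with v ≟ a | connected v a | connected v b
  ... | no v≢a   | here _       | _ = ⊥-elim (v≢a refl)
  ... | no _     | step _ e' _  | _ = _ , e'
  ... | yes refl | _ | here _       = ⊥-elim (E-irrefl e refl)
  ... | yes refl | _ | step _ e' _  = _ , e'

  branch : Fin m → Fin m → Subset m
  branch t u = select (reachable? t u)

  branch-shrinks : ∀ {t u v} → E t u → E u v → v ≢ t → ∣ branch u v ∣ < ∣ branch t u ∣
  branch-shrinks {t} {u} {v} e-tu e-uv v≢t = SubP.p⊂q⇒∣p∣<∣q∣ (inner⊆outer , u , u∈outer , u∉inner)
    where
    u≢t : u ≢ t
    u≢t = neighbour-distinct e-tu
    inner⊆outer : ∀ {y} → y ∈ branch u v → y ∈ branch t u
    inner⊆outer p = ∈-select⁺ (reachable? t u)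
      (step u≢t e-uv (avoid-transfer e-uv (E-sym e-tu) v≢t (∈-select⁻ (reachable? u v) p)))
    u∈outer : u ∈ branch t u
    u∈outer = ∈-select⁺ (reachable? t u) (here u≢t)
    u∉inner : u ∉ branch u v
    u∉inner p = ok-end (∈-select⁻ (reachable? u v) p) refl

-- Exact search trees and the tree decomposition they induce

module SearchTree {n : ℕ} (𝒫 : Fam n → Set) (𝒮 : Subset n → Set)
                  {m : ℕ} {adj : Fin m → Fin m → Bool} (tree : IsTree adj) where

  open Trees tree public

  -- arc labels l(s,t) ⊆ A (only their values on arcs matter)
  Labelling : Set
  Labelling = Fin m → Fin m → Subset n

  ExactSearchTree : Labelling → Set₁
  ExactSearchTree l = IsSearchTree 𝒫 𝒮 adj l × IsExact 𝒫 𝒮 adj l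

  π : Labelling → Fin m → Fam n
  π l t X = ∃ λ u → adj t u ≡ true × l t u ≡ X

  -- τ(w): the union of the labels of the arcs entering w (for a leaf, the
  -- label of its unique entering arc)
  enters? : ∀ (l : Labelling) w a → Dec (Σ (Fin m) λ s → E s w × a ∈ l s w)
  enters? l w a = FinP.any? (λ s → (adj s w BoolP.≟ true) ×-dec (a SubP.∈? l s w))

  leafLabel : Labelling → Fin m → Subset n
  leafLabel l w = select (enters? l w)

  ∈-leafLabel⁺ : ∀ l {w a s} → E s w → a ∈ l s w → a ∈ leafLabel l w
  ∈-leafLabel⁺ l {w} e p = ∈-select⁺ (enters? l w) (_ , e , p)

  ∈-leafLabel⁻ : ∀ l {w a} → a ∈ leafLabel l w → Σ (Fin m) λ s → E s w × a ∈ l s w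
  ∈-leafLabel⁻ l {w} p = ∈-select⁻ (enters? l w) p

  Separated : Labelling → Set
  Separated l = ∀ u v v' → E u v → E u v' → v ≢ v' → l u v ∩ l u v' ≡ ⊥

  componentPartition : Labelling → Fin m → Fam n
  componentPartition l t X = ∃ λ v → v ≢ t ×
    IsUnionOf X (λ Y → ∃ λ w → Walk adj (Avoid t) v w × Leaf adj w × leafLabel l w ≡ Y)

  module Exact (l : Labelling) (est : ExactSearchTree l) where

    open IsSearchTree (proj₁ est) public hiding (tree)

    arc-disjoint : ∀ {s t a} → E s t → a ∈ l s t → a ∈ l t s → Void
    arc-disjoint {s} {t} e = ∈-disjoint (disjoint s t e)

    arc-cover : ∀ {s t a} → E s t → a ∉ l t s → a ∈ l s t
    arc-cover {s} {t} e = ∈-cover (proj₂ est s t e)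

    block-cover : ∀ {t} → Internal adj t → ∀ a → Σ (Fin m) λ u → E t u × a ∈ l t u
    block-cover {t} int a with Equivalence.to (proj₂ (πPartition t int) a) SubP.∈⊤
    ... | _ , (u , e , refl) , p = u , e , p

    -- A label entering an internal node u continues along an arc leaving
    -- u, and not back towards t (labels of opposite arcs are disjoint).
    step-away : ∀ {t u a} → E t u → Internal adj u → a ∈ l t u →
                Σ (Fin m) λ v → E u v × v ≢ t × a ∈ l u v
    step-away {a = a} e int p with block-cover int a
    ... | v , e' , q = v , e' , (λ { refl → arc-disjoint e p q }) , q

    -- Every a ∈ l(t,u) lies in τ(w) for some leaf w of the branch of T - t
    -- at u; induction on the size of the branch.
    reach-leaf : ∀ {t u a} → E t u → a ∈ l t u →
                 Σ (Fin m) λ w → Leaf adj w × Walk adj (Avoid t) u w × a ∈ leafLabel l w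
    reach-leaf = go _ (ℕP.n<1+n _)
      where
      go : ∀ k {t u a} → ∣ branch t u ∣ < k → E t u → a ∈ l t u →
           Σ (Fin m) λ w → Leaf adj w × Walk adj (Avoid t) u w × a ∈ leafLabel l w
      go (suc k) {u = u} size e p with leaf? u
      ... | yes leaf = u , leaf , here (neighbour-distinct e) , ∈-leafLabel⁺ l e p
      ... | no int with step-away e int p
      ... | v , e' , v≢t , q with go k (ℕP.<-≤-trans (branch-shrinks e e' v≢t) (ℕP.≤-pred size)) e' q
      ... | w , leaf , W , r =
        w , leaf , step (neighbour-distinct e) e' (avoid-transfer e' (E-sym e) v≢t W) , r

    leafLabel-leaf : ∀ {s w} → Leaf adj w → E s w → leafLabel l w ≡ l s w
    leafLabel-leaf {s} {w} leaf e = SubP.⊆-antisym to (∈-leafLabel⁺ l e)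
      where
      to : ∀ {a} → a ∈ leafLabel l w → a ∈ l s w
      to {a} r with ∈-leafLabel⁻ l r
      ... | s' , e' , q = subst (λ z → a ∈ l z w) (leaf-neighbour-unique leaf (E-sym e') (E-sym e)) q

    module _ (sep : Separated l) where

      -- For separated l the converse of reach-leaf holds: along a simple walk
      -- u = x₀, x₁, …, w avoiding t, a ∈ τ(w) gives a ∈ l(x_i, x_{i+1}) and
      -- hence, by separation at x_i and exactness, a ∈ l(x_{i-1}, x_i).
      leaf-in-arc-simple : ∀ {ok : Fin m → Set} {t u w a} → E t u → Leaf adj w →
                           (W : Walk adj ok u w) → Simple W → ¬ (t ∈W W) →
                           a ∈ leafLabel l w → a ∈ l t u
      leaf-in-arc-simple {a = a} e leaf (here _) _ _ r with ∈-leafLabel⁻ l r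
      ... | s , e-s , q = subst (λ z → a ∈ l z _) (leaf-neighbour-unique leaf (E-sym e-s) (E-sym e)) q
      leaf-in-arc-simple {t = t} e leaf (step {w = u'} _ e' W) (u∉W , s) t∉W r =
        arc-cover e (∈-disjoint (sep _ u' t e' (E-sym e) u'≢t) (leaf-in-arc-simple e' leaf W s u∉W r))
        where
        u'≢t : u' ≢ t
        u'≢t refl = t∉W (inj₂ (start∈W W))

      leaf-in-arc : ∀ {t u w a} → E t u → Leaf adj w → Walk adj (Avoid t) u w →
                    a ∈ leafLabel l w → a ∈ l t u
      leaf-in-arc e leaf W with simplify W
      ... | S , s = leaf-in-arc-simple e leaf S s (λ p → ok-member S p refl)

      arc-union : ∀ {t u} → E t u →
                  IsUnionOf (l t u) (λ Y → ∃ λ w → Walk adj (Avoid t) u w × Leaf adj w × leafLabel l w ≡ Y)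
      arc-union e a =
        mk⇔ (λ p → let (w , leaf , W , r) = reach-leaf e p in leafLabel l w , (w , W , leaf , refl) , r)
            (λ { (_ , (w , W , leaf , refl) , r) → leaf-in-arc e leaf W r })

      π≈componentPartition : ∀ t → SameFam (π l t) (componentPartition l t)
      π≈componentPartition t X = mk⇔ to from
        where
        to : π l t X → componentPartition l t X
        to (u , e , refl) = u , neighbour-distinct e , arc-union e
        from : componentPartition l t X → π l t X
        from (v , v≢t , X-union) with first-entry (connected v t) v≢t
        ... | u , e , V = u , E-sym e , SubP.⊆-antisym ⊆X X⊆
          where
          ⊆X : ∀ {a} → a ∈ l t u → a ∈ X
          ⊆X {a} p with reach-leaf (E-sym e) p
          ... | w , leaf , W , r = Equivalence.from (X-union a) (leafLabel l w , (w , V ++W W , leaf , refl) , r)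
          X⊆ : ∀ {a} → a ∈ X → a ∈ l t u
          X⊆ {a} p with Equivalence.to (X-union a) p
          ... | _ , (w , W , leaf , refl) , r = leaf-in-arc (E-sym e) leaf (reverse V ++W W) r

      -- The leaf labels are pairwise disjoint: a ∈ τ(w₁) ∩ τ(w₂) with
      -- s₁ ~ w₁ would put a into both l(s₁,w₁) and l(w₁,s₁).
      leafLabels-disjoint : ∀ {w₁ w₂ a} → Leaf adj w₁ → Leaf adj w₂ → w₁ ≢ w₂ →
                            a ∈ leafLabel l w₁ → a ∈ leafLabel l w₂ → Void
      leafLabels-disjoint leaf₁ leaf₂ w₁≢w₂ p q with ∈-leafLabel⁻ l p
      ... | s₁ , e₁ , p' = arc-disjoint e₁ p'
        (leaf-in-arc (E-sym e₁) leaf₂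
          (avoid-leaf leaf₁ (connected s₁ _) (E-irrefl e₁) (λ w₂≡w₁ → w₁≢w₂ (sym w₂≡w₁))) q)

      -- Every a ∈ A lies in some leaf label: follow any arc (u,v) or (v,u).
      leafLabels-cover : HasEdge adj → ∀ a → Σ (Fin m) λ w → Leaf adj w × a ∈ leafLabel l w
      leafLabels-cover (u , v , e) a with a SubP.∈? l v u
      ... | yes p   = let (w , leaf , _ , r) = reach-leaf (E-sym e) p in w , leaf , r
      ... | no a∉vu = let (w , leaf , _ , r) = reach-leaf e (arc-cover e a∉vu) in w , leaf , r

      decomposition : IsTreeDecomposition 𝒫 𝒮 adj (leafLabel l)
      decomposition = record
        { tree       = tree
        ; τ∈𝒮       = τ∈𝒮
        ; τPartition = (λ { _ _ (w₁ , leaf₁ , refl) (w₂ , leaf₂ , refl) X≢Y →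
                           disjoint-intro λ a → leafLabels-disjoint leaf₁ leaf₂ (λ { refl → X≢Y refl }) })
                     , (λ a → mk⇔ (λ _ → let (w , leaf , r) = leafLabels-cover atLeastOneEdge a
                                          in leafLabel l w , (w , leaf , refl) , r)
                                  (λ _ → SubP.∈⊤))
        ; Pt∈𝒫      = λ t int → let (Q , Q∈𝒫 , Q≈π) = π∈𝒫 t int
                                 in Q , Q∈𝒫 , sameFam-trans Q≈π (π≈componentPartition t)
        }
        where
        τ∈𝒮 : ∀ w → Leaf adj w → 𝒮 (leafLabel l w)
        τ∈𝒮 w leaf with neighbour-exists atLeastOneEdge w
        ... | s , e = subst 𝒮 (sym (leafLabel-leaf leaf (E-sym e))) (leaf∈𝒮 s w (E-sym e) leaf)

-- Pruning a conflict between two arcs leaving the same node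

module Pruning {n : ℕ} {𝒫 : Fam n → Set} {𝒮 : Subset n → Set} (scenario : IsScenario 𝒫 𝒮)
               {m : ℕ} {adj : Fin m → Fin m → Bool} (tree : IsTree adj) where

  open SearchTree 𝒫 𝒮 tree public
  open IsScenario scenario using (SC1; SC2)

  -- the leaves with nonempty label; pruning strictly shrinks this set
  live? : ∀ (l : Labelling) w → Dec (Leaf adj w × Nonempty (leafLabel l w))
  live? l w = leaf? w ×-dec SubP.nonempty? (leafLabel l w)

  liveLeaves : Labelling → Subset m
  liveLeaves l = select (live? l)

  module Prune (l : Labelling) (est : ExactSearchTree l)
               {t u u' : Fin m} (e-tu : E t u) (e-tu' : E t u') (u≢u' : u ≢ u')
               {a₀ : Fin n} (a₀∈tu : a₀ ∈ l t u) (a₀∈tu' : a₀ ∈ l t u') where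

    open Exact l est

    t-internal : Internal adj t
    t-internal leaf = u≢u' (leaf-neighbour-unique leaf e-tu e-tu')

    InB : Fin m → Set
    InB y = Walk adj (Avoid t) u' y

    u'∈B : InB u'
    u'∈B = here (neighbour-distinct e-tu')

    t∉B : ¬ InB t
    t∉B W = ok-end W refl

    B-closed : ∀ {x y} → E x y → InB y → x ≢ t → InB x
    B-closed e y∈B x≢t = snoc y∈B x≢t (E-sym e)

    B-at-t : ∀ {y} → E t y → InB y → y ≡ u'
    B-at-t {y} e y∈B with y ≟ u'
    ... | yes y≡u' = y≡u'
    ... | no y≢u'  = ⊥-elim (neighbours-separated e-tu' e (λ u'≡y → y≢u' (sym u'≡y)) y∈B)

    path-to-t : ∀ {y} → InB y → Walk adj (λ _ → Unit) y t
    path-to-t y∈B = snoc (reverse (weaken (λ _ _ → tt) y∈B)) tt (E-sym e-tu')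

    -- (x,y) is an arc of B, or the arc (t,u'), pointing away from t
    Away : Fin m → Fin m → Set
    Away x y = E x y × InB y × ¬ Walk adj (Avoid x) y t

    away? : ∀ x y → Dec (Away x y)
    away? x y = (adj x y BoolP.≟ true) ×-dec reachable? t u' y ×-dec ¬? (reachable? x y t)

    away-from-t : ∀ {y} → E t y → InB y → Away t y
    away-from-t e y∈B = e , y∈B , λ W → ok-end W refl

    not-away-to-t : ∀ {x} → ¬ Away x t
    not-away-to-t (_ , t∈B , _) = t∉B t∈B

    -- No arc points away from t in both directions: on a simple path from y
    -- to t, either x occurs (and the part after x avoids y) or it does not.
    away-asym : ∀ {x y} → Away x y → Away y x → Void
    away-asym {x} {y} (e-xy , y∈B , ¬x-avoiding) (_ , _ , ¬y-avoiding) with simplify (path-to-t y∈B)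
    ... | S , s with x ∈W? S
    ... | yes x∈S = ¬y-avoiding (avoiding (suffix S x∈S) (start∉suffix S s x∈S (E-irrefl e-xy)))
    ... | no x∉S  = ¬x-avoiding (avoiding S x∉S)

    -- An edge xy cannot be bypassed from both sides: walks y ⇝ t avoiding
    -- x and x ⇝ t avoiding y would join two neighbours of y in T - y.
    not-bypassed-twice : ∀ {x y} → E x y → Walk adj (Avoid x) y t → Walk adj (Avoid y) x t → Void
    not-bypassed-twice e-xy W₁ W₂ with simplify W₁
    ... | here _ , _ = ok-end W₂ refl
    ... | step _ e S , (y∉S , _) =
      neighbours-separated (E-sym e-xy) e (λ x≡z → ok-start S (sym x≡z)) (W₂ ++W reverse (avoiding S y∉S))

    away-total : ∀ {x y} → E x y → InB x → InB y → Away x y ⊎ Away y x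
    away-total {x} {y} e x∈B y∈B with reachable? x y t | reachable? y x t
    ... | no ¬W₁ | _       = inj₁ (e , y∈B , ¬W₁)
    ... | yes _  | no ¬W₂  = inj₂ (E-sym e , x∈B , ¬W₂)
    ... | yes W₁ | yes W₂  = ⊥-elim (not-bypassed-twice e W₁ W₂)

    -- Since
    -- they are computed by deciding reachability, case splits on such
    -- decisions below go through toSum, so as not to abstract them in goals.
    pruned : Labelling
    pruned x y with away? x y | away? y x
    ... | yes _ | _     = ⊥
    ... | no _  | yes _ = ⊤
    ... | no _  | no _  = l x y

    pruned-away : ∀ {x y} → Away x y → pruned x y ≡ ⊥
    pruned-away {x} {y} a with away? x y
    ... | yes _ = refl
    ... | no ¬a = ⊥-elim (¬a a)

    pruned-towards : ∀ {x y} → Away y x → pruned x y ≡ ⊤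
    pruned-towards {x} {y} a with away? x y | away? y x
    ... | yes a' | _     = ⊥-elim (away-asym a' a)
    ... | no _   | yes _ = refl
    ... | no _   | no ¬a = ⊥-elim (¬a a)

    pruned-unchanged : ∀ {x y} → ¬ Away x y → ¬ Away y x → pruned x y ≡ l x y
    pruned-unchanged {x} {y} ¬a ¬a' with away? x y | away? y x
    ... | yes a | _     = ⊥-elim (¬a a)
    ... | no _  | yes a = ⊥-elim (¬a' a)
    ... | no _  | no _  = refl

    pruned-disjoint : ∀ s r → E s r → pruned s r ∩ pruned r s ≡ ⊥
    pruned-disjoint s r e with away? s r | away? r s
    ... | yes a | yes a' = ⊥-elim (away-asym a a')
    ... | yes _ | no _   = SubP.∩-zeroˡ ⊤
    ... | no _  | yes _  = SubP.∩-zeroʳ ⊤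
    ... | no _  | no _   = disjoint s r e

    pruned-exact : IsExact 𝒫 𝒮 adj pruned
    pruned-exact s r e with away? s r | away? r s
    ... | yes a | yes a' = ⊥-elim (away-asym a a')
    ... | yes _ | no _   = SubP.∪-identityˡ ⊤
    ... | no _  | yes _  = SubP.∪-zeroˡ ⊥
    ... | no _  | no _   = proj₂ est s r e

    -- At t only the arc (t,u') changes, to ∅.  A stays covered: l(t,u') is
    -- the block l(t,u) of π_t, as both contain a₀.
    unpruned-at-t : ∀ {y} → E t y → ¬ InB y → pruned t y ≡ l t y
    unpruned-at-t e y∉B = pruned-unchanged (λ (_ , y∈B , _) → y∉B y∈B) not-away-to-t

    pruned-at-t : ∀ {y} → E t y → pruned t y ≡ ⊥ ⊎ pruned t y ≡ l t y
    pruned-at-t {y} e with toSum (reachable? t u' y)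
    ... | inj₁ y∈B = inj₁ (pruned-away (away-from-t e y∈B))
    ... | inj₂ y∉B = inj₂ (unpruned-at-t e y∉B)

    cover-at-t : IsUnionOf ⊤ (π pruned t)
    cover-at-t a = mk⇔ (λ _ → cover) (λ _ → SubP.∈⊤)
      where
      from-block : ∀ {y} → E t y → ¬ InB y → a ∈ l t y → ∃ λ Y → π pruned t Y × a ∈ Y
      from-block {y} e y∉B p = pruned t y , (y , e , refl) , subst (a ∈_) (sym (unpruned-at-t e y∉B)) p
      u∉B : ¬ InB u
      u∉B u∈B = u≢u' (B-at-t e-tu u∈B)
      cover : ∃ λ Y → π pruned t Y × a ∈ Y
      cover with a SubP.∈? l t u | block-cover t-internal a
      ... | yes p   | _           = from-block e-tu u∉B p
      ... | no a∉tu | y , e , p   = from-block e y∉B p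
        where
        y∉B : ¬ InB y
        y∉B y∈B with B-at-t e y∈B
        ... | refl = ∈-disjoint (proj₁ (πPartition t t-internal) _ _ (u , e-tu , refl) (u' , e-tu' , refl)
                                   (λ tu≡tu' → a∉tu (subst (a ∈_) (sym tu≡tu') p)))
                                 a₀∈tu a₀∈tu'

    shape-at-t : ∀ X → π pruned t X → X ≡ ⊥ ⊎ π l t X
    shape-at-t X (y , e , refl) with pruned-at-t e
    ... | inj₁ q = inj₁ q
    ... | inj₂ q = inj₂ (y , e , sym q)

    partition-at-t : IsPartition (π pruned t)
    partition-at-t = partition-dropping-blocks (πPartition t t-internal) shape-at-t cover-at-t

    π-at-t∈𝒫 : π pruned t ∈Fam 𝒫
    π-at-t∈𝒫 = SC1 (π pruned t) (π l t) partition-at-t (π∈𝒫 t t-internal)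
      (coarser-by-blocks (πPartition t t-internal) λ X pX → map₂ inj₂ (shape-at-t X pX))

    -- Inside B every label becomes ∅ or A, and A occurs: on the arc
    -- starting a simple path from x to t.
    shape-in-B : ∀ {x} → InB x → ∀ X → π pruned x X → X ≡ ⊥ ⊎ X ≡ ⊤
    shape-in-B {x} x∈B X (y , e , refl) with toSum (y ≟ t)
    ... | inj₁ refl = inj₂ (pruned-towards (away-from-t (E-sym e) x∈B))
    ... | inj₂ y≢t with away-total e x∈B (B-closed (E-sym e) x∈B y≢t)
    ...   | inj₁ a = inj₁ (pruned-away a)
    ...   | inj₂ a = inj₂ (pruned-towards a)

    towards-t : ∀ {x} → InB x → π pruned x ⊤
    towards-t {x} x∈B with simplify (path-to-t x∈B)
    ... | here _ , _ = ⊥-elim (t∉B x∈B)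
    ... | step {w = y} _ e S , (x∉S , _) with y ≟ t
    ...   | yes refl = t , e , pruned-towards (away-from-t (E-sym e) x∈B)
    ...   | no y≢t with away-total e x∈B (B-closed (E-sym e) x∈B y≢t)
    ...     | inj₁ (_ , _ , ¬y-avoiding) = ⊥-elim (¬y-avoiding (avoiding S x∉S))
    ...     | inj₂ a = y , e , pruned-towards a

    unchanged-outside : ∀ {x} → x ≢ t → ¬ InB x → SameFam (π l x) (π pruned x)
    unchanged-outside {x} x≢t x∉B X =
      mk⇔ (λ (y , e , q) → y , e , trans (same e) q) (λ (y , e , q) → y , e , trans (sym (same e)) q)
      where
      same : ∀ {y} → E x y → pruned x y ≡ l x y
      same e = pruned-unchanged (λ (e' , y∈B , _) → x∉B (B-closed e' y∈B x≢t)) (λ (_ , x∈B , _) → x∉B x∈B)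

    pruned-π : ∀ x → Internal adj x → IsPartition (π pruned x) × π pruned x ∈Fam 𝒫
    pruned-π x int with toSum (x ≟ t)
    ... | inj₁ refl = partition-at-t , π-at-t∈𝒫
    ... | inj₂ x≢t with toSum (reachable? t u' x)
    ...   | inj₁ x∈B = partition , SC1 (π pruned x) (π l x) partition (π∈𝒫 x int)
                                    (coarser-by-blocks (πPartition x int) λ X pX → map₂ inj₁ (shape-in-B x∈B X pX))
      where
      partition : IsPartition (π pruned x)
      partition = partition-∅-A (shape-in-B x∈B) (towards-t x∈B)
    ...   | inj₂ x∉B = let (Q , Q∈𝒫 , Q≈π) = π∈𝒫 x int in
                     partition-resp (unchanged-outside x≢t x∉B) (πPartition x int) ,
                     Q , Q∈𝒫 , sameFam-trans Q≈π (unchanged-outside x≢t x∉B)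

    -- An arc entering a leaf never points towards t, so its label becomes ∅
    -- or stays.
    pruned-at-leaf : ∀ {s w} → E s w → Leaf adj w → pruned s w ≡ ⊥ ⊎ pruned s w ≡ l s w
    pruned-at-leaf {s} {w} e leaf with toSum (away? s w)
    ... | inj₁ a  = inj₁ (pruned-away a)
    ... | inj₂ ¬a = inj₂ (pruned-unchanged ¬a not-towards)
      where
      not-towards : ¬ Away w s
      not-towards (_ , s∈B , ¬W) =
        ¬W (avoid-leaf leaf (path-to-t s∈B) (E-irrefl e) (λ { refl → t-internal leaf }))

    w₀-data : Σ (Fin m) λ w → Leaf adj w × InB w × a₀ ∈ leafLabel l w
    w₀-data = reach-leaf e-tu' a₀∈tu'

    -- ∅ ∈ 𝒮 by SC2: ∅ is a set of the new π_t below the leaf label τ(w₀)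
    ∅∈𝒮 : 𝒮 ⊥
    ∅∈𝒮 with w₀-data
    ... | w₀ , leaf₀ , _ , r₀ with ∈-leafLabel⁻ l r₀
    ...   | s₀ , e₀ , _ =
      SC2 ⊥ (l s₀ w₀) (π pruned t) SubP.⊥⊆ (leaf∈𝒮 s₀ w₀ e₀ leaf₀) π-at-t∈𝒫
          (u' , e-tu' , pruned-away (away-from-t e-tu' u'∈B))

    pruned-leaf∈𝒮 : ∀ s w → E s w → Leaf adj w → 𝒮 (pruned s w)
    pruned-leaf∈𝒮 s w e leaf with pruned-at-leaf e leaf
    ... | inj₁ q = subst 𝒮 (sym q) ∅∈𝒮
    ... | inj₂ q = subst 𝒮 (sym q) (leaf∈𝒮 s w e leaf)

    pruned-est : ExactSearchTree pruned
    pruned-est = record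
      { tree = tree ; atLeastOneEdge = atLeastOneEdge
      ; πPartition = λ x int → proj₁ (pruned-π x int)
      ; π∈𝒫 = λ x int → proj₂ (pruned-π x int)
      ; disjoint = pruned-disjoint ; leaf∈𝒮 = pruned-leaf∈𝒮 } , pruned-exact

    -- Every live leaf stays live or dies, and w₀ dies.
    fewer-live-leaves : ∣ liveLeaves pruned ∣ < ∣ liveLeaves l ∣
    fewer-live-leaves with w₀-data
    ... | w₀ , leaf₀ , w₀∈B , r₀ =
      SubP.p⊂q⇒∣p∣<∣q∣ (still-live , w₀ , ∈-select⁺ (live? l) (leaf₀ , a₀ , r₀) , w₀-dead)
      where
      still-live : ∀ {w} → w ∈ liveLeaves pruned → w ∈ liveLeaves l
      still-live p with ∈-select⁻ (live? pruned) p
      ... | leaf , a , r with ∈-leafLabel⁻ pruned r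
      ...   | s , e , q with pruned-at-leaf e leaf
      ...     | inj₁ q′ = ⊥-elim (SubP.∉⊥ (subst (a ∈_) q′ q))
      ...     | inj₂ q′ = ∈-select⁺ (live? l) (leaf , a , ∈-leafLabel⁺ l e (subst (a ∈_) q′ q))
      w₀-dead : w₀ ∉ liveLeaves pruned
      w₀-dead p with ∈-select⁻ (live? pruned) p
      ... | _ , a , r with ∈-leafLabel⁻ pruned r
      ...   | s , e , q = SubP.∉⊥ (subst (a ∈_) (pruned-away (e , w₀∈B , leaf-isolated leaf₀ e w₀≢t)) q)
        where
        w₀≢t : w₀ ≢ t
        w₀≢t refl = t-internal leaf₀

-- Pruning until the labels are separated

module Separation {n : ℕ} {𝒫 : Fam n → Set} {𝒮 : Subset n → Set} (scenario : IsScenario 𝒫 𝒮)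
                  {m : ℕ} {adj : Fin m → Fin m → Bool} (tree : IsTree adj) where

  open Pruning scenario tree public

  Conflict : Labelling → Set
  Conflict l = ∃ λ t → ∃ λ u → ∃ λ u' → E t u × E t u' × u ≢ u' × Nonempty (l t u ∩ l t u')

  conflict? : ∀ l → Dec (Conflict l)
  conflict? l = FinP.any? λ t → FinP.any? λ u → FinP.any? λ u' →
    (adj t u BoolP.≟ true) ×-dec (adj t u' BoolP.≟ true) ×-dec ¬? (u ≟ u') ×-dec
    SubP.nonempty? (l t u ∩ l t u')

  no-conflict⇒separated : ∀ l → ¬ Conflict l → Separated l
  no-conflict⇒separated l ¬conflict t u u' e e' u≢u' =
    SubP.Empty-unique λ nonempty → ¬conflict (t , u , u' , e , e' , u≢u' , nonempty)

  -- Prune conflicts away; each round kills a live leaf, so there are at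
  -- most m rounds.
  separate : ∀ l → ExactSearchTree l → Σ Labelling λ l' → ExactSearchTree l' × Separated l'
  separate l est = go _ l (ℕP.n<1+n _) est
    where
    go : ∀ k l → ∣ liveLeaves l ∣ < k → ExactSearchTree l → Σ Labelling λ l' → ExactSearchTree l' × Separated l'
    go (suc k) l size est with conflict? l
    ... | no ¬conflict = l , est , no-conflict⇒separated l ¬conflict
    ... | yes (t , u , u' , e , e' , u≢u' , a , a∈∩) =
      let (a∈tu , a∈tu') = SubP.x∈p∩q⁻ (l t u) (l t u') a∈∩
          open Prune l est e e' u≢u' a∈tu a∈tu'
      in go k pruned (ℕP.<-≤-trans fewer-live-leaves (ℕP.≤-pred size)) pruned-est

theorem2 : (n : ℕ) → 1 ≤ n →
    (𝒫 : Fam n → Set) (𝒮 : Subset n → Set) → IsScenario 𝒫 𝒮 →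
    HasExactSearchTree 𝒫 𝒮 → HasTreeDecomposition 𝒫 𝒮
theorem2 n _ 𝒫 𝒮 scenario (m , adj , l , search , exact) = decompose (separate l (search , exact))
  where
  open Separation scenario (IsSearchTree.tree search)
  decompose : (Σ Labelling λ l' → ExactSearchTree l' × Separated l') → HasTreeDecomposition 𝒫 𝒮
  decompose (l' , est' , separated) = m , adj , leafLabel l' , Exact.decomposition l' est' separated
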